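{- Let $\mathcal{S}$ be a dilation invariant finite system of equations. The following are equivalent: (I) $\mathcal{S}$ is partition regular over $\mathbb{N}$; (II) $\mathcal{S}$ is partition regular over every multiplicatively syndetic set; (III) $\mathcal{S}$ is partition regular over some multiplicatively syndetic set $S\subseteq\mathbb{N}$.
   Context: $\mathbb{N}=\{1,2,3,\dots\}$. A finite system of equations $\mathcal{S}$ in $s$ variables consists of finitely many equations $p_i(t_1,\dots,t_s)=0$ with $p_i\in\mathbb{Q}[t_1,\dots,t_s]$. A solution is $\mathbf{x}\in\mathbb{N}^s$ satisfying all equations; it is non-trivial if its entries are not all equal. $\mathcal{S}$ is dilation invariant if whenever $\mathbf{x}$ is a solution, $\lambda\mathbf{x}$ also satisfies all equations for every $\lambda\in\mathbb{Q}$. For $B\subseteq\mathbb{N}$, $\mathcal{S}$ is partition regular over $B$ if for every $r\in\mathbb{N}$ and every $r$-colouring of $B$ there exists a monochromatic non-trivial solution with all entries in $B$. For non-empty finite $F\subset\mathbb{N}$, $S$ is multiplicatively $F$-syndetic if for every $n\in\mathbb{N}$ there is $t\in F$ with $nt\in S$; $S$ is multiplicatively syndetic if it is multiplicatively $F$-syndetic for some non-empty finite $F$. -}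

module Defs where

open import Data.Nat using (ℕ; zero; suc; _≤_)
import Data.Nat as ℕ
open import Data.Fin using (Fin)
import Data.Integer
open import Data.List using (List; [])
open import Data.List.Relation.Unary.All using (All)
open import Data.List.Membership.Propositional using (_∈_)
open import Data.Product using (Σ; _×_; ∃; ∃-syntax)
open import Data.Rational using (ℚ; 0ℚ; 1ℚ; _+_; _*_)
import Data.Rational as ℚ
open import Relation.Binary.PropositionalEquality using (_≡_; _≢_)
open import Relation.Nullary using (¬_)
open import Level using (Level; suc) renaming (zero to 0ℓ)

-- ℕ in the paper is {1,2,3,...}; we use Agda's ℕ and require positivity
-- explicitly wherever an element of the paper's ℕ is meant.

Subset : Set₁
Subset = ℕ → Set

_^ℚ_ : ℚ → ℕ → ℚ
q ^ℚ zero = 1ℚ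
q ^ℚ ℕ.suc k = q * (q ^ℚ k)

prodFin : (s : ℕ) → (Fin s → ℚ) → ℚ
prodFin zero f = 1ℚ
prodFin (ℕ.suc s) f = f Fin.zero * prodFin s (λ i → f (Fin.suc i))
  where import Data.Fin as Fin

Monomial : ℕ → Set
Monomial s = ℚ × (Fin s → ℕ)

Poly : ℕ → Set
Poly s = List (Monomial s)

evalMono : {s : ℕ} → Monomial s → (Fin s → ℚ) → ℚ
evalMono {s} (c Data.Product., e) x = c * prodFin s (λ i → x i ^ℚ e i)

eval : {s : ℕ} → Poly s → (Fin s → ℚ) → ℚ
eval [] x = 0ℚ
eval (m Data.List.∷ p) x = evalMono m x + eval p x

System : ℕ → Set
System s = List (Poly s)

Satisfiesℚ : {s : ℕ} → System s → (Fin s → ℚ) → Set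
Satisfiesℚ sys x = All (λ p → eval p x ≡ 0ℚ) sys

natℚ : ℕ → ℚ
natℚ n = (Data.Integer.+ n) ℚ./ 1

toℚ : {s : ℕ} → (Fin s → ℕ) → (Fin s → ℚ)
toℚ x i = natℚ (x i)

Positive : {s : ℕ} → (Fin s → ℕ) → Set
Positive x = ∀ i → 1 ≤ x i

IsSolution : {s : ℕ} → System s → (Fin s → ℕ) → Set
IsSolution sys x = Positive x × Satisfiesℚ sys (toℚ x)

NonTrivial : {s : ℕ} → (Fin s → ℕ) → Set
NonTrivial x = ∃[ i ] ∃[ j ] (x i ≢ x j)

DilationInvariant : {s : ℕ} → System s → Set
DilationInvariant {s} sys =
  (x : Fin s → ℕ) → IsSolution sys x →
  (λ' : ℚ) → Satisfiesℚ sys (λ i → λ' * natℚ (x i))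

-- partition regular over B ⊆ ℕ: every r-colouring (of ℕ, restricted to B)
-- admits a monochromatic non-trivial solution with entries in B.
PartitionRegularOver : {s : ℕ} → System s → Subset → Set
PartitionRegularOver {s} sys B =
  (r : ℕ) → 1 ≤ r → (c : ℕ → Fin r) →
  ∃[ x ] (IsSolution sys x × NonTrivial x × (∀ i → B (x i))
          × (∀ i j → c (x i) ≡ c (x j)))

ℕ⁺ : Subset
ℕ⁺ n = 1 ≤ n

MultFSyndetic : List ℕ → Subset → Set
MultFSyndetic F S =
  ¬ (F ≡ []) × All (λ t → 1 ≤ t) F ×
  ((n : ℕ) → 1 ≤ n → ∃[ t ] (t ∈ F × S (n ℕ.* t)))

MultSyndetic : Subset → Set
MultSyndetic S = ∃[ F ] MultFSyndetic F S

-- Colour n by the pair (which multiplier t ∈ F puts n·t into S, colour of n·t).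
-- Partition regularity over ℕ gives a non-trivial solution x monochromatic for
-- this finer colouring, so a single t serves every entry; by dilation invariance
-- x·t is again a solution, it lies in S, and it is monochromatic for the original
-- colouring. The converse directions are immediate, ℕ itself being syndetic.
module Submission where

open import Defs
open import Data.Nat using (ℕ)
open import Data.Product using (_×_; ∃-syntax)
open import Function.Bundles using (_⇔_)

open import Data.Nat using (zero; suc; pred; _*_; _≤_; z≤n; s≤s; NonZero; >-nonZero; >-nonZero⁻¹)
open import Data.Nat.Properties using (*-mono-≤; *-cancelʳ-≡; *-identityʳ)
open import Data.Nat.Coprimality using (1-coprimeTo)
import Data.Nat.Coprimality as Coprimality
open import Data.Fin using (Fin; combine)
open import Data.Fin.Properties using (nonZeroIndex; combine-injectiveˡ; combine-injectiveʳ)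
open import Data.Integer using (+_)
import Data.Integer as ℤ
open import Data.Integer.Properties using (pos-*)
open import Data.Rational using (ℚ; mkℚ; _/_)
import Data.Rational as ℚ
import Data.Rational.Properties as ℚ
open import Data.List using ([]; _∷_; length; lookup)
open import Data.List.Relation.Unary.All as All using (All; []; _∷_)
open import Data.List.Relation.Unary.Any as Any using (here)
open import Data.List.Relation.Unary.Any.Properties using (lookup-index)
open import Data.List.Membership.Propositional.Properties using (∈-lookup)
open import Data.Product using (Σ; _,_; proj₁; proj₂)
open import Function.Bundles using (mk⇔)
open import Relation.Binary.PropositionalEquality
  using (_≡_; refl; sym; trans; cong; cong₂; subst; module ≡-Reasoning)

natℚ≡mkℚ : ∀ n → natℚ n ≡ mkℚ (+ n) 0 (Coprimality.sym (1-coprimeTo n))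
natℚ≡mkℚ n = ℚ.normalize-coprime (Coprimality.sym (1-coprimeTo n))

natℚ-* : ∀ m n → natℚ (m * n) ≡ natℚ m ℚ.* natℚ n
natℚ-* m n = begin
  + (m * n) / 1     ≡⟨ cong (_/ 1) (pos-* m n) ⟩
  (+ m ℤ.* + n) / 1 ≡⟨ sym (cong₂ ℚ._*_ (natℚ≡mkℚ m) (natℚ≡mkℚ n)) ⟩
  natℚ m ℚ.* natℚ n ∎
  where open ≡-Reasoning

prodFin-cong : ∀ s {f g : Fin s → ℚ} → (∀ i → f i ≡ g i) → prodFin s f ≡ prodFin s g
prodFin-cong zero    f≗g = refl
prodFin-cong (suc s) f≗g = cong₂ ℚ._*_ (f≗g Fin.zero) (prodFin-cong s (λ i → f≗g (Fin.suc i)))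
  where import Data.Fin as Fin

eval-cong : ∀ {s} (p : Poly s) {x y : Fin s → ℚ} → (∀ i → x i ≡ y i) → eval p x ≡ eval p y
eval-cong []            x≗y = refl
eval-cong ((c , e) ∷ p) x≗y =
  cong₂ ℚ._+_ (cong (c ℚ.*_) (prodFin-cong _ (λ i → cong (_^ℚ e i) (x≗y i)))) (eval-cong p x≗y)

Satisfiesℚ-cong : ∀ {s} (sys : System s) {x y : Fin s → ℚ} →
  (∀ i → x i ≡ y i) → Satisfiesℚ sys x → Satisfiesℚ sys y
Satisfiesℚ-cong []        x≗y []       = []
Satisfiesℚ-cong (p ∷ sys) x≗y (px ∷ sx) = trans (sym (eval-cong p x≗y)) px ∷ Satisfiesℚ-cong sys x≗y sx

Monochromatic : ∀ {s r} → (ℕ → Fin r) → (Fin s → ℕ) → Set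
Monochromatic c x = ∀ i j → c (x i) ≡ c (x j)

module _ {s} (sys : System s) where

  IsSolution-dilate : DilationInvariant sys → ∀ {x} → IsSolution sys x →
    ∀ t → 1 ≤ t → IsSolution sys (λ i → x i * t)
  IsSolution-dilate dil {x} sol@(x-pos , _) t t-pos =
    (λ i → *-mono-≤ (x-pos i) t-pos) ,
    Satisfiesℚ-cong sys dilation≡toℚ (dil x sol (natℚ t))
    where
    dilation≡toℚ : ∀ i → natℚ t ℚ.* natℚ (x i) ≡ natℚ (x i * t)
    dilation≡toℚ i = trans (ℚ.*-comm (natℚ t) (natℚ (x i))) (sym (natℚ-* (x i) t))

  PartitionRegularOver-mono : ∀ {S B : Subset} → (∀ {n} → 1 ≤ n → S n → B n) →
    PartitionRegularOver sys S → PartitionRegularOver sys B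
  PartitionRegularOver-mono S⊆B pr r r-pos c
    with x , sol@(x-pos , _) , nt , x∈S , mono ← pr r r-pos c
    = x , sol , nt , (λ i → S⊆B (x-pos i) (x∈S i)) , mono

  -- Colour by the product colouring n ↦ (g n, c n), with m · r colours.
  PartitionRegularOver-refine : ∀ {B} → PartitionRegularOver sys B →
    ∀ {m} (g : ℕ → Fin m) {r} → 1 ≤ r → (c : ℕ → Fin r) →
    ∃[ x ] (IsSolution sys x × NonTrivial x × (∀ i → B (x i))
            × Monochromatic c x × Monochromatic g x)
  PartitionRegularOver-refine pr {m} g {r} r-pos c
    with x , sol , nt , x∈B , mono ←
           pr (m * r) (*-mono-≤ (>-nonZero⁻¹ m {{nonZeroIndex (g 0)}}) r-pos) (λ n → combine (g n) (c n))
    = x , sol , nt , x∈B ,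
      (λ i j → combine-injectiveʳ (g (x i)) _ (g (x j)) _ (mono i j)) ,
      (λ i j → combine-injectiveˡ (g (x i)) _ (g (x j)) _ (mono i j))

NonTrivial-dilate : ∀ {s} {x : Fin s → ℕ} → NonTrivial x →
  ∀ t .{{_ : NonZero t}} → NonTrivial (λ i → x i * t)
NonTrivial-dilate (i , j , xi≢xj) t = i , j , λ eq → xi≢xj (*-cancelʳ-≡ _ _ t eq)

-- At n = 0 the chosen multiplier is junk (that of 1).
MultFSyndetic-choice : ∀ {F S} → MultFSyndetic F S →
  Σ (ℕ → Fin (length F)) λ ι → ∀ n → 1 ≤ n → S (n * lookup F (ι n))
MultFSyndetic-choice {F} {S} (_ , _ , syndetic) = ι , ι-works
  where
  ι : ℕ → Fin (length F)
  ι n = Any.index (proj₁ (proj₂ (syndetic (suc (pred n)) (s≤s z≤n))))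

  ι-works : ∀ n → 1 ≤ n → S (n * lookup F (ι n))
  ι-works (suc n) _ with t , t∈F , nt∈S ← syndetic (suc n) (s≤s z≤n)
    = subst (λ t → S (suc n * t)) (lookup-index t∈F) nt∈S

lookup-positive : ∀ {F} → All (1 ≤_) F → ∀ i → 1 ≤ lookup F i
lookup-positive F-pos i = All.lookup F-pos (∈-lookup i)

ℕ⁺-multSyndetic : MultSyndetic ℕ⁺
ℕ⁺-multSyndetic = 1 ∷ [] , (λ ()) , s≤s z≤n ∷ [] ,
  λ n n-pos → 1 , here refl , subst (1 ≤_) (sym (*-identityʳ n)) n-pos

PartitionRegularOver-multSyndetic : ∀ {s} (sys : System s) → DilationInvariant sys →
  PartitionRegularOver sys ℕ⁺ → ∀ S → MultSyndetic S → PartitionRegularOver sys S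
PartitionRegularOver-multSyndetic sys dil pr S (F , syndetic@(_ , F-pos , _)) r r-pos c
  with ι , ι-works ← MultFSyndetic-choice {S = S} syndetic
  with PartitionRegularOver-refine sys {ℕ⁺} pr ι r-pos (λ n → c (n * lookup F (ι n)))
... | x , sol@(x-pos , _) , nt@(k₀ , _) , _ , mono-c , mono-ι =
  (λ i → x i * t) ,
  IsSolution-dilate sys dil sol t t-pos ,
  NonTrivial-dilate nt t {{>-nonZero t-pos}} ,
  (λ i → subst S (sym (on-fibre i)) (ι-works (x i) (x-pos i))) ,
  (λ i j → trans (cong c (on-fibre i)) (trans (mono-c i j) (sym (cong c (on-fibre j)))))
  where
  t : ℕ
  t = lookup F (ι (x k₀))

  t-pos : 1 ≤ t
  t-pos = lookup-positive F-pos (ι (x k₀))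

  on-fibre : ∀ i → x i * t ≡ x i * lookup F (ι (x i))
  on-fibre i = cong (λ j → x i * lookup F j) (mono-ι k₀ i)

corollary2p4 : (s : ℕ) (sys : System s) → DilationInvariant sys →
    (PartitionRegularOver sys ℕ⁺ ⇔ ((S : Subset) → MultSyndetic S → PartitionRegularOver sys S))
    × (PartitionRegularOver sys ℕ⁺ ⇔ (∃[ S ] (MultSyndetic S × PartitionRegularOver sys S)))
corollary2p4 s sys dil =
  mk⇔ (PartitionRegularOver-multSyndetic sys dil) (λ pr → pr ℕ⁺ ℕ⁺-multSyndetic) ,
  mk⇔ (λ pr → ℕ⁺ , ℕ⁺-multSyndetic , pr)
      (λ (S , _ , pr) → PartitionRegularOver-mono sys {S} (λ n-pos _ → n-pos) pr)
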